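{- Fix an integer $k\geq 5$ and let $G$ be a finite simple graph. Suppose $EMH_{2,2}(G)\cong EMH_{k,k}(G)\cong 0$. Then $MH_{k,k}(G)\cong DMH_{k,k}(G)$.
   Context: Graphs are finite, simple and undirected; $d$ is the path metric. A $k$-trail in $G=(V,E)$ is $(x_0,\dots,x_k)\in V^{k+1}$ with $x_i\neq x_{i+1}$ and $d(x_i,x_{i+1})<\infty$ for $0\le i\le k-1$; its length is $\sum_i d(x_i,x_{i+1})$. $MC_{k,\ell}(G)$ is the free abelian group on $k$-trails of length $\ell$ with differential $\partial_{k,\ell}=\sum_{i=1}^{k-1}(-1)^i\partial^i_{k,\ell}$, where $\partial^i_{k,\ell}(x_0,\dots,x_k)=(x_0,\dots,\widehat{x_i},\dots,x_k)$ if this tuple has length $\ell$ and $0$ otherwise; $MH_{k,\ell}(G)$ is its homology. A trail is eulerian if its entries are pairwise distinct; eulerian trails of length $\ell$ span a subcomplex $EMC_{*,\ell}(G)$ with homology $EMH_{k,\ell}(G)$. The discriminant magnitude chain complex is the quotient $DMC_{*,\ell}(G)=MC_{*,\ell}(G)/EMC_{*,\ell}(G)$ with the induced differential, and $DMH_{k,\ell}(G)$ is its homology. -}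

module Defs where

open import Data.Bool using (Bool; true; false; _∧_; _∨_; not; if_then_else_)
open import Data.Nat as ℕ using (ℕ; zero; suc)
open import Data.Fin using (Fin; zero; suc; inject₁; toℕ)
open import Data.Fin.Properties using (_≟_)
open import Data.Vec using (Vec; []; _∷_; insertAt)
open import Data.Maybe using (Maybe; just; nothing)
open import Data.Integer using (ℤ; _+_; _*_; -_; _-_; 0ℤ; 1ℤ)
open import Data.Integer.Properties
  using (+-identityˡ; +-assoc; +-comm; *-distribˡ-+; neg-distrib-+; neg-distribʳ-*; *-zeroʳ)
open import Data.Unit using (⊤; tt)
open import Data.Product using (Σ; _×_; _,_; ∃; ∃₂)
open import Relation.Nullary.Decidable using (⌊_⌋)
open import Relation.Binary.PropositionalEquality
open import Algebra.Bundles.Raw using (RawGroup)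
open import Algebra.Morphism.Structures using (module GroupMorphisms)

record Graph : Set where
  field
    n          : ℕ
    adj        : Fin n → Fin n → Bool
    adj-sym    : ∀ x y → adj x y ≡ adj y x
    adj-irrefl : ∀ x → adj x x ≡ false

sumFin : ∀ m → (Fin m → ℤ) → ℤ
sumFin zero    f = 0ℤ
sumFin (suc m) f = f zero + sumFin m (λ i → f (suc i))

anyFin : ∀ m → (Fin m → Bool) → Bool
anyFin zero    p = false
anyFin (suc m) p = p zero ∨ anyFin m (λ i → p (suc i))

sign : ℕ → ℤ
sign zero    = 1ℤ
sign (suc i) = - sign i

_≅_ : RawGroup _ _ → RawGroup _ _ → Set
A ≅ B = Σ (RawGroup.Carrier A → RawGroup.Carrier B)
          (GroupMorphisms.IsGroupIsomorphism A B)

TrivialGroup : RawGroup _ _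
TrivialGroup = record
  { Carrier = ⊤ ; _≈_ = λ _ _ → ⊤ ; _∙_ = λ _ _ → tt ; ε = tt ; _⁻¹ = λ _ → tt }

sumFin-cong : ∀ m {f g : Fin m → ℤ} → (∀ i → f i ≡ g i) → sumFin m f ≡ sumFin m g
sumFin-cong zero    e = refl
sumFin-cong (suc m) e = cong₂ _+_ (e zero) (sumFin-cong m (λ i → e (suc i)))

interchange : ∀ a b c d → (a + b) + (c + d) ≡ (a + c) + (b + d)
interchange a b c d = begin
  (a + b) + (c + d)   ≡⟨ +-assoc a b (c + d) ⟩
  a + (b + (c + d))   ≡⟨ cong (a +_) (sym (+-assoc b c d)) ⟩
  a + ((b + c) + d)   ≡⟨ cong (λ z → a + (z + d)) (+-comm b c) ⟩
  a + ((c + b) + d)   ≡⟨ cong (a +_) (+-assoc c b d) ⟩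
  a + (c + (b + d))   ≡⟨ sym (+-assoc a c (b + d)) ⟩
  (a + c) + (b + d)   ∎
  where open ≡-Reasoning

sumFin-+ : ∀ m (f g : Fin m → ℤ) →
  sumFin m (λ i → f i + g i) ≡ sumFin m f + sumFin m g
sumFin-+ zero    f g = refl
sumFin-+ (suc m) f g =
  trans (cong (f zero + g zero +_) (sumFin-+ m (λ i → f (suc i)) (λ i → g (suc i))))
        (interchange (f zero) (g zero) _ _)

sumFin-neg : ∀ m (f : Fin m → ℤ) → sumFin m (λ i → - f i) ≡ - sumFin m f
sumFin-neg zero    f = refl
sumFin-neg (suc m) f =
  trans (cong (- f zero +_) (sumFin-neg m (λ i → f (suc i))))
        (sym (neg-distrib-+ (f zero) _))

sumFin-0 : ∀ m → sumFin m (λ _ → 0ℤ) ≡ 0ℤ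
sumFin-0 zero    = refl
sumFin-0 (suc m) = trans (+-identityˡ _) (sumFin-0 m)

module _ (G : Graph) where
  open Graph G

  reach : ℕ → Fin n → Fin n → Bool
  reach zero    x y = ⌊ x ≟ y ⌋
  reach (suc m) x y = reach m x y ∨ anyFin n (λ z → reach m x z ∧ adj z y)

  distAux : ℕ → ℕ → Fin n → Fin n → Maybe ℕ
  distAux m zero       x y = nothing
  distAux m (suc fuel) x y = if reach m x y then just m else distAux (suc m) fuel x y

  -- path metric: d(x,y) = least m with a walk of m edges, nothing = ∞.
  -- (A shortest path has at most n - 1 edges, so checking m = 0 … n - 1 suffices.)
  dist : Fin n → Fin n → Maybe ℕ
  dist x y = distAux 0 n x y

  addM : Maybe ℕ → Maybe ℕ → Maybe ℕ
  addM (just a) (just b) = just (a ℕ.+ b)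
  addM _        _        = nothing

  tupleLen : ∀ {k} → Vec (Fin n) (suc k) → Maybe ℕ
  tupleLen (x ∷ [])     = just 0
  tupleLen (x ∷ y ∷ xs) = addM (dist x y) (tupleLen (y ∷ xs))

  consecDistinct : ∀ {k} → Vec (Fin n) (suc k) → Bool
  consecDistinct (x ∷ [])     = true
  consecDistinct (x ∷ y ∷ xs) = not ⌊ x ≟ y ⌋ ∧ consecDistinct (y ∷ xs)

  lenIs : Maybe ℕ → ℕ → Bool
  lenIs nothing  ℓ = false
  lenIs (just m) ℓ = ⌊ m ℕ.≟ ℓ ⌋

  isTrail : ∀ {k} → ℕ → Vec (Fin n) (suc k) → Bool
  isTrail ℓ x = consecDistinct x ∧ lenIs (tupleLen x) ℓ

  elem : ∀ {m} → Fin n → Vec (Fin n) m → Bool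
  elem x []       = false
  elem x (y ∷ ys) = ⌊ x ≟ y ⌋ ∨ elem x ys

  allDistinct : ∀ {m} → Vec (Fin n) m → Bool
  allDistinct []       = true
  allDistinct (x ∷ xs) = not (elem x xs) ∧ allDistinct xs

  isEulerianTrail : ∀ {k} → ℕ → Vec (Fin n) (suc k) → Bool
  isEulerianTrail ℓ x = isTrail ℓ x ∧ allDistinct x

  -- MC_{k,ℓ}(G) is the
  -- subgroup of those supported on k-trails of length ℓ (free abelian on them,
  -- as there are finitely many); EMC_{k,ℓ}(G) those supported on eulerian ones.

  Chain : ℕ → Set
  Chain k = Vec (Fin n) (suc k) → ℤ

  InMC : ∀ k → ℕ → Chain k → Set
  InMC k ℓ c = ∀ x → isTrail ℓ x ≡ false → c x ≡ 0ℤ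

  InEMC : ∀ k → ℕ → Chain k → Set
  InEMC k ℓ c = ∀ x → isEulerianTrail ℓ x ≡ false → c x ≡ 0ℤ

  _+ᶜ_ : ∀ {k} → Chain k → Chain k → Chain k
  (c +ᶜ c') x = c x + c' x

  -ᶜ_ : ∀ {k} → Chain k → Chain k
  (-ᶜ c) x = - c x

  0ᶜ : ∀ {k} → Chain k
  0ᶜ x = 0ℤ

  -- The coefficient of a k-trail y of length ℓ in ∂c is
  --   Σ_{i=1}^{k} (-1)^i Σ_v c(y_0,…,y_{i-1},v,y_i,…,y_k)
  -- (here i = 1 + j, j : Fin k).
  ∂ : ∀ k → ℕ → Chain (suc k) → Chain k
  ∂ k ℓ c y =
    if isTrail ℓ y
    then sumFin k (λ j → sign (suc (toℕ j)) *
           sumFin n (λ v → c (insertAt y (suc (inject₁ j)) v)))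
    else 0ℤ

  ∂-+ : ∀ k ℓ c c' y → ∂ k ℓ (c +ᶜ c') y ≡ ∂ k ℓ c y + ∂ k ℓ c' y
  ∂-+ k ℓ c c' y with isTrail ℓ y
  ... | false = refl
  ... | true  =
    trans (sumFin-cong k (λ j →
             trans (cong (sign (suc (toℕ j)) *_) (sumFin-+ n _ _))
                   (*-distribˡ-+ (sign (suc (toℕ j))) _ _)))
          (sumFin-+ k _ _)

  ∂-neg : ∀ k ℓ c y → ∂ k ℓ (-ᶜ c) y ≡ - ∂ k ℓ c y
  ∂-neg k ℓ c y with isTrail ℓ y
  ... | false = refl
  ... | true  =
    trans (sumFin-cong k (λ j →
             trans (cong (sign (suc (toℕ j)) *_) (sumFin-neg n _))
                   (sym (neg-distribʳ-* (sign (suc (toℕ j))) _))))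
          (sumFin-neg k _)

  ∂-0 : ∀ k ℓ y → ∂ k ℓ 0ᶜ y ≡ 0ℤ
  ∂-0 k ℓ y with isTrail ℓ y
  ... | false = refl
  ... | true  =
    trans (sumFin-cong k (λ j →
             trans (cong (sign (suc (toℕ j)) *_) (sumFin-0 n))
                   (*-zeroʳ (sign (suc (toℕ j))))))
          (sumFin-0 k)

  Vanish : ∀ {k} → (Vec (Fin n) (suc k) → Bool) → Chain k → Set
  Vanish P c = ∀ x → P x ≡ false → c x ≡ 0ℤ

  vanish-+ : ∀ {k} P (c c' : Chain k) → Vanish P c → Vanish P c' → Vanish P (c +ᶜ c')
  vanish-+ P c c' p p' x e rewrite p x e | p' x e = refl

  vanish-neg : ∀ {k} P (c : Chain k) → Vanish P c → Vanish P (-ᶜ c)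
  vanish-neg P c p x e rewrite p x e = refl

  vanish-0 : ∀ {k} P → Vanish P (0ᶜ {k})
  vanish-0 P x e = refl

  IsCycle : ∀ k → ℕ → Chain k → Set
  IsCycle zero    ℓ c = ⊤
  IsCycle (suc k) ℓ c = ∀ y → ∂ k ℓ c y ≡ 0ℤ

  IsDCycle : ∀ k → ℕ → Chain k → Set
  IsDCycle zero    ℓ c = ⊤
  IsDCycle (suc k) ℓ c = InEMC k ℓ (∂ k ℓ c)

  cyc-+ : ∀ k ℓ c c' → IsCycle k ℓ c → IsCycle k ℓ c' → IsCycle k ℓ (c +ᶜ c')
  cyc-+ zero    ℓ c c' p p' = tt
  cyc-+ (suc k) ℓ c c' p p' y rewrite ∂-+ k ℓ c c' y | p y | p' y = refl

  cyc-neg : ∀ k ℓ c → IsCycle k ℓ c → IsCycle k ℓ (-ᶜ c)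
  cyc-neg zero    ℓ c p = tt
  cyc-neg (suc k) ℓ c p y rewrite ∂-neg k ℓ c y | p y = refl

  cyc-0 : ∀ k ℓ → IsCycle k ℓ 0ᶜ
  cyc-0 zero    ℓ = tt
  cyc-0 (suc k) ℓ y = ∂-0 k ℓ y

  dcyc-+ : ∀ k ℓ c c' → IsDCycle k ℓ c → IsDCycle k ℓ c' → IsDCycle k ℓ (c +ᶜ c')
  dcyc-+ zero    ℓ c c' p p' = tt
  dcyc-+ (suc k) ℓ c c' p p' y e rewrite ∂-+ k ℓ c c' y | p y e | p' y e = refl

  dcyc-neg : ∀ k ℓ c → IsDCycle k ℓ c → IsDCycle k ℓ (-ᶜ c)
  dcyc-neg zero    ℓ c p = tt
  dcyc-neg (suc k) ℓ c p y e rewrite ∂-neg k ℓ c y | p y e = refl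

  dcyc-0 : ∀ k ℓ → IsDCycle k ℓ 0ᶜ
  dcyc-0 zero    ℓ = tt
  dcyc-0 (suc k) ℓ y e = ∂-0 k ℓ y

  -- Homology groups, as raw groups whose carrier is the cycles and whose
  -- equality is "differ by a boundary" (quotients are not available).

  MH : ℕ → ℕ → RawGroup _ _
  MH k ℓ = record
    { Carrier = Σ (Chain k) (λ c → InMC k ℓ c × IsCycle k ℓ c)
    ; _≈_ = λ { (c , _) (c' , _) →
        ∃ λ (b : Chain (suc k)) → InMC (suc k) ℓ b × (∀ x → c x - c' x ≡ ∂ k ℓ b x) }
    ; _∙_ = λ { (c , p , q) (c' , p' , q') →
        (c +ᶜ c') , vanish-+ (isTrail ℓ) c c' p p' , cyc-+ k ℓ c c' q q' }
    ; ε = 0ᶜ , vanish-0 (isTrail ℓ) , cyc-0 k ℓ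
    ; _⁻¹ = λ { (c , p , q) → (-ᶜ c) , vanish-neg (isTrail ℓ) c p , cyc-neg k ℓ c q }
    }

  EMH : ℕ → ℕ → RawGroup _ _
  EMH k ℓ = record
    { Carrier = Σ (Chain k) (λ c → InEMC k ℓ c × IsCycle k ℓ c)
    ; _≈_ = λ { (c , _) (c' , _) →
        ∃ λ (b : Chain (suc k)) → InEMC (suc k) ℓ b × (∀ x → c x - c' x ≡ ∂ k ℓ b x) }
    ; _∙_ = λ { (c , p , q) (c' , p' , q') →
        (c +ᶜ c') , vanish-+ (isEulerianTrail ℓ) c c' p p' , cyc-+ k ℓ c c' q q' }
    ; ε = 0ᶜ , vanish-0 (isEulerianTrail ℓ) , cyc-0 k ℓ
    ; _⁻¹ = λ { (c , p , q) → (-ᶜ c) , vanish-neg (isEulerianTrail ℓ) c p , cyc-neg k ℓ c q }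
    }

  -- DMH_{k,ℓ}(G): homology of the quotient DMC_{*,ℓ} = MC_{*,ℓ}/EMC_{*,ℓ}.
  -- A class of DMC_{k,ℓ} is represented by c ∈ MC_{k,ℓ}; it is a cycle iff
  -- ∂c ∈ EMC_{k-1,ℓ}, and c ~ c' iff c - c' ∈ im ∂_{k+1,ℓ} + EMC_{k,ℓ}.
  DMH : ℕ → ℕ → RawGroup _ _
  DMH k ℓ = record
    { Carrier = Σ (Chain k) (λ c → InMC k ℓ c × IsDCycle k ℓ c)
    ; _≈_ = λ { (c , _) (c' , _) →
        ∃₂ λ (b : Chain (suc k)) (e : Chain k) →
          InMC (suc k) ℓ b × InEMC k ℓ e × (∀ x → c x - c' x ≡ ∂ k ℓ b x + e x) }
    ; _∙_ = λ { (c , p , q) (c' , p' , q') →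
        (c +ᶜ c') , vanish-+ (isTrail ℓ) c c' p p' , dcyc-+ k ℓ c c' q q' }
    ; ε = 0ᶜ , vanish-0 (isTrail ℓ) , dcyc-0 k ℓ
    ; _⁻¹ = λ { (c , p , q) → (-ᶜ c) , vanish-neg (isTrail ℓ) c p , dcyc-neg k ℓ c q }
    }

{-# OPTIONS --safe #-}

-- EMH_{2,2}(G) = 0 makes G free of triangles and of 4-cycles: a triangle abc, or a square abcb′, carries
-- the nonzero eulerian 2-cycle abc, resp. abc − ab′c, which is no boundary since no 3-trail has length 2.
-- As no (k+1)-trail has length k, MH_{k,k} and EMH_{k,k} are plain cycle groups, so the identity on
-- representatives MH_{k,k} → DMH_{k,k} is injective once EMH_{k,k} = 0. For surjectivity let ∂c be
-- eulerian. A k-trail x of length k is a walk along edges; if x is not eulerian and x_j ≠ x_{j+2} for some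
-- j, then, as k ≥ 5, there is such a j for which deleting x_{j+1} leaves a non-eulerian trail y. Without
-- triangles and squares x is the only trail contributing to (∂c)(y), so c(x) = ±(∂c)(y) = 0. Hence the
-- non-eulerian part of c is a cycle, and it differs from c by an eulerian chain.
module Submission where

open import Defs
open import Algebra.Bundles.Raw using (RawGroup)
open import Algebra.Morphism.Structures using (module GroupMorphisms)
open GroupMorphisms.IsGroupIsomorphism using (injective)
open import Data.Bool using (Bool; true; false; _∧_; _∨_; not; if_then_else_)
open import Data.Bool.Properties using (if-cong; ∧-identityʳ; ∧-zeroʳ; ∨-zeroʳ; not-injective; ¬-not)
open import Data.Empty using (⊥; ⊥-elim)
open import Data.Fin using (Fin; zero; suc; inject₁; toℕ; fromℕ<)
open import Data.Fin.Properties using (_≟_)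
import Data.Fin.Properties as FinP
open import Data.Integer using (ℤ; _+_; _*_; -_; _-_; 0ℤ; 1ℤ)
import Data.Integer.Properties as ℤ
open import Data.Maybe using (just)
open import Data.Nat using (ℕ; zero; suc; _≤_; _<_; z≤n; s≤s)
import Data.Nat as ℕ
import Data.Nat.Properties as ℕ
open import Data.Product using (∃; ∃₂; _×_; _,_; proj₁; proj₂)
open import Data.Unit using (⊤; tt)
open import Data.Vec using (Vec; []; _∷_; lookup; insertAt; removeAt)
open import Data.Vec.Properties using (insertAt-removeAt; removeAt-insertAt; removeAt-punchOut)
open import Function using (_∘_; case_of_)
open import Function.Definitions using (Surjective)
open import Relation.Binary.Definitions using (DecidableEquality)
open import Relation.Binary.PropositionalEquality
open import Relation.Nullary using (Dec; ¬_; yes; no; _×-dec_; ¬?)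
open import Relation.Nullary.Decidable using (⌊_⌋; isYes; True; toWitness; isYes≗does; dec-true; dec-false)

isYes-true : ∀ {A : Set} (d : Dec A) → A → isYes d ≡ true
isYes-true d a = trans (isYes≗does d) (dec-true d a)

isYes-false : ∀ {A : Set} (d : Dec A) → ¬ A → isYes d ≡ false
isYes-false d ¬a = trans (isYes≗does d) (dec-false d ¬a)

isYes-true⁻ : ∀ {A : Set} (d : Dec A) → isYes d ≡ true → A
isYes-true⁻ (yes a) _ = a

isYes-false⁻ : ∀ {A : Set} (d : Dec A) → isYes d ≡ false → ¬ A
isYes-false⁻ (no ¬a) _ = ¬a

∧-true⁻ : ∀ {a b : Bool} → a ∧ b ≡ true → a ≡ true × b ≡ true
∧-true⁻ {true} {true} _ = refl , refl

anyFin-true : ∀ m (p : Fin m → Bool) z → p z ≡ true → anyFin m p ≡ true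
anyFin-true (suc m) p zero    pz rewrite pz = refl
anyFin-true (suc m) p (suc z) pz rewrite anyFin-true m (p ∘ suc) z pz = ∨-zeroʳ (p zero)

anyFin-true⁻ : ∀ m (p : Fin m → Bool) → anyFin m p ≡ true → ∃ λ z → p z ≡ true
anyFin-true⁻ (suc m) p any with p zero in pz
... | true  = zero , pz
... | false = let z , pz = anyFin-true⁻ m (p ∘ suc) any in suc z , pz

anyFin-false : ∀ m (p : Fin m → Bool) → (∀ z → p z ≡ false) → anyFin m p ≡ false
anyFin-false zero    p none = refl
anyFin-false (suc m) p none rewrite none zero = anyFin-false m (p ∘ suc) (none ∘ suc)

sumFin-zero : ∀ m {f : Fin m → ℤ} → (∀ i → f i ≡ 0ℤ) → sumFin m f ≡ 0ℤ
sumFin-zero m f≡0 = trans (sumFin-cong m f≡0) (sumFin-0 m)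

sumFin-single : ∀ m (f : Fin m → ℤ) i₀ → (∀ i → i ≢ i₀ → f i ≡ 0ℤ) → sumFin m f ≡ f i₀
sumFin-single (suc m) f zero     off = begin
  f zero + sumFin m (f ∘ suc) ≡⟨ cong (f zero +_) (sumFin-zero m (λ i → off (suc i) λ ())) ⟩
  f zero + 0ℤ                 ≡⟨ ℤ.+-identityʳ (f zero) ⟩
  f zero                      ∎
  where open ≡-Reasoning
sumFin-single (suc m) f (suc i₀) off = begin
  f zero + sumFin m (f ∘ suc) ≡⟨ cong (_+ sumFin m (f ∘ suc)) (off zero λ ()) ⟩
  0ℤ + sumFin m (f ∘ suc)     ≡⟨ ℤ.+-identityˡ _ ⟩
  sumFin m (f ∘ suc)          ≡⟨ sumFin-single m (f ∘ suc) i₀ (λ i i≢ → off (suc i) (i≢ ∘ FinP.suc-injective)) ⟩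
  f (suc i₀)                  ∎
  where open ≡-Reasoning

sign*≡0⇒≡0 : ∀ s z → sign s * z ≡ 0ℤ → z ≡ 0ℤ
sign*≡0⇒≡0 zero    z e = trans (sym (ℤ.*-identityˡ z)) e
sign*≡0⇒≡0 (suc s) z e =
  sign*≡0⇒≡0 s z (trans (sym (ℤ.neg-involutive _)) (cong -_ (trans (ℤ.neg-distribˡ-* (sign s) z) e)))

tight-sum : ∀ {d L m} → 1 ≤ d → m ≤ L → d ℕ.+ L ≡ suc m → d ≡ 1 × L ≡ m
tight-sum {suc d} {L} _ m≤L 1+d+L≡1+m with ℕ.suc-injective 1+d+L≡1+m
... | refl with ℕ.n≤0⇒n≡0 (ℕ.+-cancelʳ-≤ L d 0 m≤L)
... | refl = refl , refl

toℕ-≢ : ∀ {m} {a b : Fin m} {s t} → toℕ a ≡ s → toℕ b ≡ t → s ≢ t → a ≢ b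
toℕ-≢ ta tb s≢t a≡b = s≢t (trans (sym ta) (trans (cong toℕ a≡b) tb))

2≤-of-distinct : ∀ {m} {a b : Fin m} → a ≢ b → 2 ≤ m
2≤-of-distinct {a = zero}  {zero}  a≢b = ⊥-elim (a≢b refl)
2≤-of-distinct {a = zero}  {suc b} _   = s≤s (ℕ.≤-trans (s≤s z≤n) (FinP.toℕ<n b))
2≤-of-distinct {a = suc a} {zero}  _   = s≤s (ℕ.≤-trans (s≤s z≤n) (FinP.toℕ<n a))
2≤-of-distinct {a = suc a} {suc b} a≢b = ℕ.m≤n⇒m≤1+n (2≤-of-distinct (a≢b ∘ cong suc))

3≤-of-distinct : ∀ {m} {a b c : Fin m} → a ≢ b → b ≢ c → a ≢ c → 3 ≤ m
3≤-of-distinct {a = zero}  {zero}  {_}     a≢b _   _   = ⊥-elim (a≢b refl)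
3≤-of-distinct {a = zero}  {suc _} {zero}  _   _   a≢c = ⊥-elim (a≢c refl)
3≤-of-distinct {a = suc _} {zero}  {zero}  _   b≢c _   = ⊥-elim (b≢c refl)
3≤-of-distinct {a = zero}  {suc _} {suc _} _   b≢c _   = s≤s (2≤-of-distinct (b≢c ∘ cong suc))
3≤-of-distinct {a = suc _} {zero}  {suc _} _   _   a≢c = s≤s (2≤-of-distinct (a≢c ∘ cong suc))
3≤-of-distinct {a = suc _} {suc _} {zero}  a≢b _   _   = s≤s (2≤-of-distinct (a≢b ∘ cong suc))
3≤-of-distinct {a = suc _} {suc _} {suc _} a≢b b≢c a≢c =
  ℕ.m≤n⇒m≤1+n (3≤-of-distinct (a≢b ∘ cong suc) (b≢c ∘ cong suc) (a≢c ∘ cong suc))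

pattern 6+ n = suc (suc (suc (suc (suc (suc n)))))

Clear : ℕ → ℕ → ℕ → Set
Clear u i o = u ≤ 3 × ℕ.suc u ≢ i × ℕ.suc u ≢ o × ¬ (u ≡ i × 2 ℕ.+ u ≡ o) × ¬ (u ≡ o × 2 ℕ.+ u ≡ i)

clear? : ∀ u i o → Dec (Clear u i o)
clear? u i o = u ℕ.≤? 3 ×-dec ¬? (ℕ.suc u ℕ.≟ i) ×-dec ¬? (ℕ.suc u ℕ.≟ o)
  ×-dec ¬? ((u ℕ.≟ i) ×-dec (2 ℕ.+ u ℕ.≟ o)) ×-dec ¬? ((u ℕ.≟ o) ×-dec (2 ℕ.+ u ℕ.≟ i))

clear-exists : ∀ i o → ∃ λ u → Clear u i o
clear-exists i o = let u , c = table i o in u , toWitness c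
  where
  -- u ≤ 3 can only clash with i, o ≤ 5, so each pattern 6+ _ stands for all larger values.
  table : ∀ i o → ∃ λ u → True (clear? u i o)
  table 0      = λ { 0 → 0 , _ ; 1 → 1 , _ ; 2 → 2 , _ ; 3 → 0 , _ ; 4 → 0 , _ ; 5 → 0 , _ ; (6+ _) → 0 , _ }
  table 1      = λ { 0 → 1 , _ ; 1 → 1 , _ ; 2 → 2 , _ ; 3 → 3 , _ ; 4 → 1 , _ ; 5 → 1 , _ ; (6+ _) → 1 , _ }
  table 2      = λ { 0 → 2 , _ ; 1 → 2 , _ ; 2 → 0 , _ ; 3 → 0 , _ ; 4 → 0 , _ ; 5 → 0 , _ ; (6+ _) → 0 , _ }
  table 3      = λ { 0 → 0 , _ ; 1 → 3 , _ ; 2 → 0 , _ ; 3 → 0 , _ ; 4 → 0 , _ ; 5 → 0 , _ ; (6+ _) → 0 , _ }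
  table 4      = λ { 0 → 0 , _ ; 1 → 1 , _ ; 2 → 0 , _ ; 3 → 0 , _ ; 4 → 0 , _ ; 5 → 0 , _ ; (6+ _) → 0 , _ }
  table 5      = λ { 0 → 0 , _ ; 1 → 1 , _ ; 2 → 0 , _ ; 3 → 0 , _ ; 4 → 0 , _ ; 5 → 0 , _ ; (6+ _) → 0 , _ }
  table (6+ _) = λ { 0 → 0 , _ ; 1 → 1 , _ ; 2 → 0 , _ ; 3 → 0 , _ ; 4 → 0 , _ ; 5 → 0 , _ ; (6+ _) → 0 , _ }

RepeatAvoiding : ∀ {A : Set} → (ℕ → A) → ℕ → ℕ → Set
RepeatAvoiding g N i = ∃₂ λ p q → p ≤ N × q ≤ N × p ≢ q × p ≢ i × q ≢ i × g p ≡ g q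

Deletable : ∀ {A : Set} → (ℕ → A) → ℕ → ℕ → Set
Deletable g m t = t < m × g t ≢ g (2 ℕ.+ t) × RepeatAvoiding g (suc m) (suc t)

module _ {A : Set} (_≟ᴬ_ : DecidableEquality A) (g : ℕ → A) where

  private
    u≢2+u : ∀ u → u ≢ 2 ℕ.+ u
    u≢2+u u = ℕ.<⇒≢ (ℕ.m<n+m u (s≤s z≤n))

  -- Take u clear of i = 1 + t and o. If g u ≢ g (2 + u), delete 1 + u and keep the repeat (i, o);
  -- otherwise (u, 2 + u) is a repeat, which avoids i or, chained with (i, o), yields one that does.
  deletable-via-repeat-at : ∀ {m t o} → 4 ≤ m → t < m → g t ≢ g (2 ℕ.+ t) →
    o ≤ suc m → o ≢ suc t → g o ≡ g (suc t) → ∃ (Deletable g m)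
  deletable-via-repeat-at {m} {t} {o} 4≤m t<m ¬back o≤ o≢ go≡
    with clear-exists (suc t) o
  ... | u , u≤3 , 1+u≢i , 1+u≢o , ¬[u≡i,2+u≡o] , ¬[u≡o,2+u≡i]
    with ℕ.<-≤-trans (s≤s u≤3) 4≤m | g u ≟ᴬ g (2 ℕ.+ u) | u ℕ.≟ suc t | 2 ℕ.+ u ℕ.≟ suc t
  ... | u<m | no ¬backᵤ | _ | _ =
    u , u<m , ¬backᵤ , suc t , o , ℕ.m≤n⇒m≤1+n t<m , o≤ , o≢ ∘ sym , 1+u≢i ∘ sym , 1+u≢o ∘ sym , sym go≡
  ... | u<m | yes backᵤ | no u≢i | no 2+u≢i =
    t , t<m , ¬back , u , 2 ℕ.+ u , ℕ.<⇒≤ (ℕ.m≤n⇒m≤1+n u<m) , s≤s u<m , u≢2+u u , u≢i , 2+u≢i , backᵤ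
  ... | u<m | yes backᵤ | yes u≡i | _ =
    t , t<m , ¬back , 2 ℕ.+ u , o , s≤s u<m , o≤ , (λ e → ¬[u≡i,2+u≡o] (u≡i , e)) ,
    (λ e → u≢2+u u (trans u≡i (sym e))) , o≢ , trans (sym backᵤ) (trans (cong g u≡i) (sym go≡))
  ... | u<m | yes backᵤ | no u≢i | yes 2+u≡i =
    t , t<m , ¬back , u , o , ℕ.<⇒≤ (ℕ.m≤n⇒m≤1+n u<m) , o≤ , (λ e → ¬[u≡o,2+u≡i] (e , 2+u≡i)) ,
    u≢i , o≢ , trans backᵤ (trans (cong g 2+u≡i) (sym go≡))

  deletable-exists : ∀ {m p q t} → 4 ≤ m → p ≤ suc m → q ≤ suc m → p ≢ q → g p ≡ g q →
    t < m → g t ≢ g (2 ℕ.+ t) → ∃ (Deletable g m)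
  deletable-exists {t = t} 4≤m p≤ q≤ p≢q gp≡gq t<m ¬back with _ ℕ.≟ suc t | _ ℕ.≟ suc t
  ... | no p≢i   | no q≢i = t , t<m , ¬back , _ , _ , p≤ , q≤ , p≢q , p≢i , q≢i , gp≡gq
  ... | yes refl | _      = deletable-via-repeat-at 4≤m t<m ¬back q≤ (p≢q ∘ sym) (sym gp≡gq)
  ... | no _     | yes refl = deletable-via-repeat-at 4≤m t<m ¬back p≤ p≢q gp≡gq

-- Positions beyond the last one read the last entry; only positions ≤ m are ever used.
lookupℕ : ∀ {A : Set} {m} → Vec A (suc m) → ℕ → A
lookupℕ (a ∷ _)      zero    = a
lookupℕ (a ∷ [])     (suc _) = a
lookupℕ (_ ∷ b ∷ xs) (suc t) = lookupℕ (b ∷ xs) t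

lookupℕ-toℕ : ∀ {A : Set} {m} (x : Vec A (suc m)) {i : Fin (suc m)} {t} → toℕ i ≡ t → lookupℕ x t ≡ lookup x i
lookupℕ-toℕ (a ∷ xs)     {zero}  refl = refl
lookupℕ-toℕ (a ∷ b ∷ xs) {suc i} refl = lookupℕ-toℕ (b ∷ xs) {i} refl

Backtrack : ∀ {A : Set} {m} → Vec A (2 ℕ.+ m) → Fin m → Set
Backtrack x j = lookup x (inject₁ (inject₁ j)) ≡ lookup x (suc (suc j))

Backtrack⇒lookupℕ : ∀ {A : Set} {m} (x : Vec A (2 ℕ.+ m)) {j : Fin m} {t} → toℕ j ≡ t →
  Backtrack x j → lookupℕ x t ≡ lookupℕ x (2 ℕ.+ t)
Backtrack⇒lookupℕ x {j} tj back =
  trans (lookupℕ-toℕ x (trans (FinP.toℕ-inject₁ (inject₁ j)) (trans (FinP.toℕ-inject₁ j) tj)))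
        (trans back (sym (lookupℕ-toℕ x (cong (2 ℕ.+_) tj))))

lookupℕ⇒Backtrack : ∀ {A : Set} {m} (x : Vec A (2 ℕ.+ m)) {j : Fin m} {t} → toℕ j ≡ t →
  lookupℕ x t ≡ lookupℕ x (2 ℕ.+ t) → Backtrack x j
lookupℕ⇒Backtrack x {j} tj back =
  trans (sym (lookupℕ-toℕ x (trans (FinP.toℕ-inject₁ (inject₁ j)) (trans (FinP.toℕ-inject₁ j) tj))))
        (trans back (lookupℕ-toℕ x (cong (2 ℕ.+_) tj)))

face : ∀ {A : Set} {m} → Vec A (2 ℕ.+ m) → Fin m → Vec A (suc m)
face x j = removeAt x (suc (inject₁ j))

face-lookup-left : ∀ {A : Set} {m} (x : Vec A (2 ℕ.+ m)) (j : Fin m) →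
  lookup (face x j) (inject₁ j) ≡ lookup x (inject₁ (inject₁ j))
face-lookup-left (a ∷ b ∷ c ∷ xs) zero    = refl
face-lookup-left (a ∷ b ∷ c ∷ xs) (suc j) = face-lookup-left (b ∷ c ∷ xs) j

face-lookup-right : ∀ {A : Set} {m} (x : Vec A (2 ℕ.+ m)) (j : Fin m) →
  lookup (face x j) (suc j) ≡ lookup x (suc (suc j))
face-lookup-right (a ∷ b ∷ c ∷ xs) zero    = refl
face-lookup-right (a ∷ b ∷ c ∷ xs) (suc j) = face-lookup-right (b ∷ c ∷ xs) j

insertAt-Backtrack : ∀ {A : Set} {m} (y : Vec A (suc m)) (j : Fin m) v →
  Backtrack (insertAt y (suc (inject₁ j)) v) j → lookup y (inject₁ j) ≡ lookup y (suc j)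
insertAt-Backtrack y j v back =
  subst (λ z → lookup z (inject₁ j) ≡ lookup z (suc j)) (removeAt-insertAt y (suc (inject₁ j)) v)
    (trans (face-lookup-left x j) (trans back (sym (face-lookup-right x j))))
  where
  x = insertAt y (suc (inject₁ j)) v

module _ (G : Graph) where
  open Graph G

  adj⇒≢ : ∀ {a b} → adj a b ≡ true → a ≢ b
  adj⇒≢ {a} ab refl = case trans (sym (adj-irrefl a)) ab of λ ()

  reach-0⇒≡ : ∀ {a b} → reach G 0 a b ≡ true → a ≡ b
  reach-0⇒≡ {a} {b} = isYes-true⁻ (a ≟ b)

  adj⇒reach-1 : ∀ {a b} → adj a b ≡ true → reach G 1 a b ≡ true
  adj⇒reach-1 {a} {b} ab
    rewrite anyFin-true n (λ z → ⌊ a ≟ z ⌋ ∧ adj z b) a (trans (cong (_∧ adj a b) (isYes-true (a ≟ a) refl)) ab)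
    = ∨-zeroʳ _

  reach-1⇒adj : ∀ {a b} → a ≢ b → reach G 1 a b ≡ true → adj a b ≡ true
  reach-1⇒adj {a} {b} a≢b r
    rewrite isYes-false (a ≟ b) a≢b with anyFin-true⁻ n (λ z → ⌊ a ≟ z ⌋ ∧ adj z b) r
  ... | z , az with a ≟ z
  ... | yes refl = az

  path⇒reach-2 : ∀ {a b c} → adj a b ≡ true → adj b c ≡ true → reach G 2 a c ≡ true
  path⇒reach-2 {a} {b} {c} ab bc
    rewrite anyFin-true n (λ z → reach G 1 a z ∧ adj z c) b (trans (cong (_∧ adj b c) (adj⇒reach-1 ab)) bc)
    = ∨-zeroʳ _

  distAux-reach : ∀ m fuel {a b r} → distAux G m fuel a b ≡ just r → reach G r a b ≡ true
  distAux-reach m (suc fuel) {a} {b} d with reach G m a b in r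
  distAux-reach m (suc fuel) refl | true  = r
  distAux-reach m (suc fuel) d    | false = distAux-reach (suc m) fuel d

  distAux-least : ∀ m fuel {a b r} → m ≤ r → r < m ℕ.+ fuel → reach G r a b ≡ true →
    (∀ s → s < r → reach G s a b ≡ false) → distAux G m fuel a b ≡ just r
  distAux-least m zero m≤r r<m+0 _ _ = ⊥-elim (ℕ.<⇒≱ (subst (_ <_) (ℕ.+-identityʳ m) r<m+0) m≤r)
  distAux-least m (suc fuel) {r = r} m≤r r< reached below with m ℕ.≟ r
  ... | yes refl = if-cong reached
  ... | no m≢r   = trans (if-cong (below m m<r))
    (distAux-least (suc m) fuel m<r (subst (r <_) (ℕ.+-suc m fuel) r<) reached below)
    where
    m<r : m < r
    m<r = ℕ.≤∧≢⇒< m≤r m≢r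

  dist≡just : ∀ {a b r} → r < n → reach G r a b ≡ true → (∀ s → s < r → reach G s a b ≡ false) →
    dist G a b ≡ just r
  dist≡just = distAux-least 0 n z≤n

  dist≡0⇒≡ : ∀ {a b} → dist G a b ≡ just 0 → a ≡ b
  dist≡0⇒≡ d = reach-0⇒≡ (distAux-reach 0 n d)

  dist≡1⇒adj : ∀ {a b} → a ≢ b → dist G a b ≡ just 1 → adj a b ≡ true
  dist≡1⇒adj a≢b d = reach-1⇒adj a≢b (distAux-reach 0 n d)

  adj⇒dist≡1 : ∀ {a b} → adj a b ≡ true → dist G a b ≡ just 1
  adj⇒dist≡1 {a} {b} ab = dist≡just (2≤-of-distinct (adj⇒≢ ab)) (adj⇒reach-1 ab) λ where
    zero    _            → isYes-false (a ≟ b) (adj⇒≢ ab)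
    (suc _) (s≤s ())

  path⇒dist≡2 : ∀ {a b c} → adj a b ≡ true → adj b c ≡ true → a ≢ c → adj a c ≡ false → dist G a c ≡ just 2
  path⇒dist≡2 {a} {b} {c} ab bc a≢c ¬ac =
    dist≡just (3≤-of-distinct (adj⇒≢ ab) (adj⇒≢ bc) a≢c) (path⇒reach-2 ab bc) λ where
      zero          _                → isYes-false (a ≟ c) a≢c
      (suc zero)    _                → ¬reach-1
      (suc (suc _)) (s≤s (s≤s ()))
    where
    ¬reach-1 : reach G 1 a c ≡ false
    ¬reach-1 rewrite isYes-false (a ≟ c) a≢c = anyFin-false n _ step
      where
      step : ∀ z → (⌊ a ≟ z ⌋ ∧ adj z c) ≡ false
      step z with a ≟ z
      ... | yes refl = ¬ac
      ... | no _     = refl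

  IsWalk : ∀ {m} → Vec (Fin n) (suc m) → Set
  IsWalk (a ∷ [])     = ⊤
  IsWalk (a ∷ b ∷ xs) = adj a b ≡ true × IsWalk (b ∷ xs)

  consecDistinct-∷⁻ : ∀ {m} a b (xs : Vec (Fin n) m) → consecDistinct G (a ∷ b ∷ xs) ≡ true →
    a ≢ b × consecDistinct G (b ∷ xs) ≡ true
  consecDistinct-∷⁻ a b xs cd with ∧-true⁻ {not ⌊ a ≟ b ⌋} cd
  ... | a≢b , cd′ = isYes-false⁻ (a ≟ b) (not-injective a≢b) , cd′

  isTrail-intro : ∀ {m ℓ} (x : Vec (Fin n) (suc m)) → consecDistinct G x ≡ true → tupleLen G x ≡ just ℓ →
    isTrail G ℓ x ≡ true
  isTrail-intro {ℓ = ℓ} x cd len rewrite cd | len = isYes-true (ℓ ℕ.≟ ℓ) refl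

  isTrail⁻ : ∀ {m ℓ} (x : Vec (Fin n) (suc m)) → isTrail G ℓ x ≡ true →
    consecDistinct G x ≡ true × tupleLen G x ≡ just ℓ
  isTrail⁻ {ℓ = ℓ} x t with ∧-true⁻ {consecDistinct G x} t
  ... | cd , len = cd , lenIs⁻ (tupleLen G x) len
    where
    lenIs⁻ : ∀ r → lenIs G r ℓ ≡ true → r ≡ just ℓ
    lenIs⁻ (just m) e = cong just (isYes-true⁻ (m ℕ.≟ ℓ) e)

  walk-shape : ∀ {m} (x : Vec (Fin n) (suc m)) → IsWalk x →
    consecDistinct G x ≡ true × tupleLen G x ≡ just m
  walk-shape (a ∷ [])     _        = refl , refl
  walk-shape (a ∷ b ∷ xs) (ab , w) with walk-shape (b ∷ xs) w
  ... | cd , len rewrite isYes-false (a ≟ b) (adj⇒≢ ab) | cd | len | adj⇒dist≡1 ab = refl , refl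

  walk⇒trail : ∀ {m} (x : Vec (Fin n) (suc m)) → IsWalk x → isTrail G m x ≡ true
  walk⇒trail x w = let cd , len = walk-shape x w in isTrail-intro x cd len

  addM≡just⁻ : ∀ {u v L} → addM G u v ≡ just L → ∃₂ λ d L′ → u ≡ just d × v ≡ just L′ × d ℕ.+ L′ ≡ L
  addM≡just⁻ {just d} {just L′} refl = d , L′ , refl , refl , refl

  dist≥1 : ∀ {a b d} → a ≢ b → dist G a b ≡ just d → 1 ≤ d
  dist≥1 a≢b dab = ℕ.n≢0⇒n>0 λ { refl → a≢b (dist≡0⇒≡ dab) }

  steps≤length : ∀ {m L} (x : Vec (Fin n) (suc m)) → consecDistinct G x ≡ true → tupleLen G x ≡ just L → m ≤ L
  steps≤length (a ∷ [])     _  _   = z≤n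
  steps≤length (a ∷ b ∷ xs) cd len with consecDistinct-∷⁻ a b xs cd | addM≡just⁻ {dist G a b} len
  ... | a≢b , cd′ | d , L′ , dab , len′ , refl = ℕ.+-mono-≤ (dist≥1 a≢b dab) (steps≤length (b ∷ xs) cd′ len′)

  length≡steps⇒walk : ∀ {m} (x : Vec (Fin n) (suc m)) → consecDistinct G x ≡ true → tupleLen G x ≡ just m →
    IsWalk x
  length≡steps⇒walk (a ∷ [])     _  _   = tt
  length≡steps⇒walk (a ∷ b ∷ xs) cd len with consecDistinct-∷⁻ a b xs cd | addM≡just⁻ {dist G a b} len
  ... | a≢b , cd′ | d , L′ , dab , len′ , d+L′≡
    with tight-sum (dist≥1 a≢b dab) (steps≤length (b ∷ xs) cd′ len′) d+L′≡
  ... | refl , refl = dist≡1⇒adj a≢b dab , length≡steps⇒walk (b ∷ xs) cd′ len′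

  trail⇒walk : ∀ {m} (x : Vec (Fin n) (suc m)) → isTrail G m x ≡ true → IsWalk x
  trail⇒walk x t = let cd , len = isTrail⁻ x t in length≡steps⇒walk x cd len

  isTrail-too-short : ∀ {ℓ} (x : Vec (Fin n) (2 ℕ.+ ℓ)) → isTrail G ℓ x ≡ false
  isTrail-too-short {ℓ} x with isTrail G ℓ x in t
  ... | false = refl
  ... | true  = let cd , len = isTrail⁻ x t in ⊥-elim (ℕ.<-irrefl refl (steps≤length x cd len))

  walk-tail : ∀ {m} a (x : Vec (Fin n) (suc m)) → IsWalk (a ∷ x) → IsWalk x
  walk-tail a (b ∷ xs) (_ , w) = w

  walk-step : ∀ {m} (y : Vec (Fin n) (suc m)) (s : Fin m) → IsWalk y →
    adj (lookup y (inject₁ s)) (lookup y (suc s)) ≡ true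
  walk-step (a ∷ b ∷ ys) zero    (ab , _) = ab
  walk-step (a ∷ b ∷ ys) (suc s) (_ , w)  = walk-step (b ∷ ys) s w

  consecDistinct-step : ∀ {m} (y : Vec (Fin n) (suc m)) (s : Fin m) → consecDistinct G y ≡ true →
    lookup y (inject₁ s) ≢ lookup y (suc s)
  consecDistinct-step (a ∷ b ∷ ys) zero    cd = proj₁ (consecDistinct-∷⁻ a b ys cd)
  consecDistinct-step (a ∷ b ∷ ys) (suc s) cd = consecDistinct-step (b ∷ ys) s (proj₂ (consecDistinct-∷⁻ a b ys cd))

  walk-insertAt-elsewhere : ∀ {m} (y : Vec (Fin n) (suc m)) p v (s : Fin m) → IsWalk (insertAt y p v) →
    p ≢ suc (inject₁ s) → adj (lookup y (inject₁ s)) (lookup y (suc s)) ≡ true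
  walk-insertAt-elsewhere (a ∷ b ∷ ys) zero             v s       w p≢ = walk-step (a ∷ b ∷ ys) s (walk-tail v _ w)
  walk-insertAt-elsewhere (a ∷ b ∷ ys) (suc zero)       v zero    w p≢ = ⊥-elim (p≢ refl)
  walk-insertAt-elsewhere (a ∷ b ∷ ys) (suc (suc p))    v zero    (ab , _) p≢ = ab
  walk-insertAt-elsewhere (a ∷ b ∷ ys) (suc p)          v (suc s) w p≢ =
    walk-insertAt-elsewhere (b ∷ ys) p v s (walk-tail a _ w) (p≢ ∘ cong suc)

  walk-insertAt : ∀ {m} (y : Vec (Fin n) (suc m)) (s : Fin m) v → IsWalk (insertAt y (suc (inject₁ s)) v) →
    adj (lookup y (inject₁ s)) v ≡ true × adj v (lookup y (suc s)) ≡ true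
  walk-insertAt (a ∷ b ∷ ys) zero    v (av , vb , _) = av , vb
  walk-insertAt (a ∷ b ∷ ys) (suc s) v w             = walk-insertAt (b ∷ ys) s v (walk-tail a _ w)

  face-shape : ∀ {m} (x : Vec (Fin n) (2 ℕ.+ m)) (j : Fin m) → IsWalk x → ¬ Backtrack x j →
    adj (lookup x (inject₁ (inject₁ j))) (lookup x (suc (suc j))) ≡ false →
    consecDistinct G (face x j) ≡ true × tupleLen G (face x j) ≡ just (suc m)
  face-shape (a ∷ b ∷ c ∷ xs) zero    (ab , bc , w) a≢c ¬ac with walk-shape (c ∷ xs) w
  ... | cd , len rewrite isYes-false (a ≟ c) a≢c | cd | len | path⇒dist≡2 ab bc a≢c ¬ac = refl , refl
  face-shape (a ∷ b ∷ c ∷ xs) (suc j) (ab , w) ¬back ¬ad with face-shape (b ∷ c ∷ xs) j w ¬back ¬ad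
  ... | cd , len rewrite isYes-false (a ≟ b) (adj⇒≢ ab) | cd | len | adj⇒dist≡1 ab = refl , refl

  ∂-cong : ∀ k ℓ {b b′ : Chain G (suc k)} → (∀ w → b w ≡ b′ w) → ∀ y → ∂ G k ℓ b y ≡ ∂ G k ℓ b′ y
  ∂-cong k ℓ b≡b′ y with isTrail G ℓ y
  ... | false = refl
  ... | true  = sumFin-cong k λ j → cong (sign (suc (toℕ j)) *_) (sumFin-cong n λ v → b≡b′ _)

  ∂-zero : ∀ k ℓ {b : Chain G (suc k)} → (∀ w → b w ≡ 0ℤ) → ∀ y → ∂ G k ℓ b y ≡ 0ℤ
  ∂-zero k ℓ b≡0 y = trans (∂-cong k ℓ b≡0 y) (∂-0 G k ℓ y)

  InEMC⇒InMC : ∀ {k ℓ} {c : Chain G k} → InEMC G k ℓ c → InMC G k ℓ c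
  InEMC⇒InMC inEMC x t = inEMC x (cong (_∧ allDistinct G x) t)

  InMC-short⇒0 : ∀ {ℓ} {b : Chain G (suc ℓ)} → InMC G (suc ℓ) ℓ b → ∀ w → b w ≡ 0ℤ
  InMC-short⇒0 inMC w = inMC w (isTrail-too-short w)

  InMC⇒supported-on-walks : ∀ {k} {c : Chain G k} → InMC G k k c → ∀ x → ¬ IsWalk x → c x ≡ 0ℤ
  InMC⇒supported-on-walks {k} inMC x ¬walk with isTrail G k x in t
  ... | false = inMC x t
  ... | true  = ⊥-elim (¬walk (trail⇒walk x t))

  elem-true⁻ : ∀ {m} z (xs : Vec (Fin n) m) → elem G z xs ≡ true → ∃ λ q → lookup xs q ≡ z
  elem-true⁻ z (y ∷ ys) e with z ≟ y
  ... | yes z≡y = zero , sym z≡y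
  ... | no _    = let q , yq≡z = elem-true⁻ z ys e in suc q , yq≡z

  elem-true : ∀ {m} z (xs : Vec (Fin n) m) q → lookup xs q ≡ z → elem G z xs ≡ true
  elem-true z (y ∷ ys) zero    refl = cong (_∨ elem G y ys) (isYes-true (y ≟ y) refl)
  elem-true z (y ∷ ys) (suc q) yq≡z = trans (cong (⌊ z ≟ y ⌋ ∨_) (elem-true z ys q yq≡z)) (∨-zeroʳ _)

  allDistinct-false⁻ : ∀ {m} (x : Vec (Fin n) m) → allDistinct G x ≡ false →
    ∃₂ λ a b → a ≢ b × lookup x a ≡ lookup x b
  allDistinct-false⁻ (z ∷ xs) nd with elem G z xs in e
  ... | true  = let q , xq≡z = elem-true⁻ z xs e in zero , suc q , (λ ()) , sym xq≡z
  ... | false = let a , b , a≢b , xa≡xb = allDistinct-false⁻ xs nd in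
    suc a , suc b , a≢b ∘ FinP.suc-injective , xa≡xb

  allDistinct-false : ∀ {m} (x : Vec (Fin n) m) {a b} → a ≢ b → lookup x a ≡ lookup x b → allDistinct G x ≡ false
  allDistinct-false (z ∷ xs) {zero}  {zero}  a≢b _ = ⊥-elim (a≢b refl)
  allDistinct-false (z ∷ xs) {zero}  {suc b} _   xa≡xb rewrite elem-true z xs b (sym xa≡xb) = refl
  allDistinct-false (z ∷ xs) {suc a} {zero}  _   xa≡xb rewrite elem-true z xs a xa≡xb = refl
  allDistinct-false (z ∷ xs) {suc a} {suc b} a≢b xa≡xb
    rewrite allDistinct-false xs (a≢b ∘ cong suc) xa≡xb = ∧-zeroʳ _

  removeAt-allDistinct-false : ∀ {m} (x : Vec (Fin n) (suc m)) {i a b} → i ≢ a → i ≢ b → a ≢ b →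
    lookup x a ≡ lookup x b → allDistinct G (removeAt x i) ≡ false
  removeAt-allDistinct-false x i≢a i≢b a≢b xa≡xb =
    allDistinct-false (removeAt x _) (a≢b ∘ FinP.punchOut-injective i≢a i≢b)
      (trans (removeAt-punchOut x i≢a) (trans xa≡xb (sym (removeAt-punchOut x i≢b))))

  deletable-face : ∀ {k} → 4 ≤ k → (x : Vec (Fin n) (2 ℕ.+ k)) → allDistinct G x ≡ false →
    (j : Fin k) → ¬ Backtrack x j → ∃ λ j′ → ¬ Backtrack x j′ × allDistinct G (face x j′) ≡ false
  deletable-face 4≤k x nd j ¬back with allDistinct-false⁻ x nd
  ... | a , b , a≢b , xa≡xb
    with deletable-exists _≟_ (lookupℕ x) 4≤k (ℕ.≤-pred (FinP.toℕ<n a)) (ℕ.≤-pred (FinP.toℕ<n b))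
           (a≢b ∘ FinP.toℕ-injective) (trans (lookupℕ-toℕ x refl) (trans xa≡xb (sym (lookupℕ-toℕ x refl))))
           (FinP.toℕ<n j) (¬back ∘ lookupℕ⇒Backtrack x refl)
  ... | t , t<k , ¬backₜ , p , q , p≤ , q≤ , p≢q , p≢ , q≢ , xp≡xq =
    j′ , ¬backₜ ∘ Backtrack⇒lookupℕ x tj ,
    removeAt-allDistinct-false x (toℕ-≢ ti tp (p≢ ∘ sym)) (toℕ-≢ ti tq (q≢ ∘ sym)) (toℕ-≢ tp tq p≢q)
      (trans (sym (lookupℕ-toℕ x tp)) (trans xp≡xq (lookupℕ-toℕ x tq)))
    where
    j′ = fromℕ< t<k
    tj : toℕ j′ ≡ t
    tj = FinP.toℕ-fromℕ< t<k
    ti : toℕ (suc (inject₁ j′)) ≡ suc t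
    ti = cong suc (trans (FinP.toℕ-inject₁ j′) tj)
    tp : toℕ (fromℕ< (s≤s p≤)) ≡ p
    tp = FinP.toℕ-fromℕ< (s≤s p≤)
    tq : toℕ (fromℕ< (s≤s q≤)) ≡ q
    tq = FinP.toℕ-fromℕ< (s≤s q≤)

  EulerianCyclesVanish : ℕ → Set
  EulerianCyclesVanish k = ∀ c → InEMC G k k c → IsCycle G k k c → ∀ x → c x ≡ 0ℤ

  EMH≅0⇒eulerian-cycles-vanish : ∀ k → EMH G k k ≅ TrivialGroup → EulerianCyclesVanish k
  EMH≅0⇒eulerian-cycles-vanish k (_ , iso) c inEMC cyc x
    with injective iso {c , inEMC , cyc} {RawGroup.ε (EMH G k k)} tt
  ... | b , inEMCᵇ , c≡∂b = begin
    c x         ≡⟨ ℤ.+-identityʳ (c x) ⟨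
    c x - 0ℤ    ≡⟨ c≡∂b x ⟩
    ∂ G k k b x ≡⟨ ∂-zero k k (InMC-short⇒0 (InEMC⇒InMC inEMCᵇ)) x ⟩
    0ℤ          ∎
    where open ≡-Reasoning

  TriangleFree : Set
  TriangleFree = ∀ {a b c} → adj a b ≡ true → adj b c ≡ true → adj a c ≡ true → ⊥

  SquareFree : Set
  SquareFree = ∀ {a b b′ c} → a ≢ c → adj a b ≡ true → adj b c ≡ true → adj a b′ ≡ true → adj b′ c ≡ true → b ≡ b′

  basis₂ : Fin n → Fin n → Fin n → Chain G 2
  basis₂ a b c (x ∷ y ∷ z ∷ []) = if ⌊ x ≟ a ⌋ ∧ ⌊ y ≟ b ⌋ ∧ ⌊ z ≟ c ⌋ then 1ℤ else 0ℤ

  basis₂-at : ∀ a b c → basis₂ a b c (a ∷ b ∷ c ∷ []) ≡ 1ℤ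
  basis₂-at a b c rewrite isYes-true (a ≟ a) refl | isYes-true (b ≟ b) refl | isYes-true (c ≟ c) refl = refl

  path-isEulerianTrail : ∀ {a b c} → adj a b ≡ true → adj b c ≡ true → a ≢ c →
    isEulerianTrail G 2 (a ∷ b ∷ c ∷ []) ≡ true
  path-isEulerianTrail {a} {b} {c} ab bc a≢c
    rewrite walk⇒trail (a ∷ b ∷ c ∷ []) (ab , bc , tt)
          | isYes-false (a ≟ b) (adj⇒≢ ab) | isYes-false (a ≟ c) a≢c | isYes-false (b ≟ c) (adj⇒≢ bc) = refl

  basis₂-InEMC : ∀ {a b c} → isEulerianTrail G 2 (a ∷ b ∷ c ∷ []) ≡ true → InEMC G 2 2 (basis₂ a b c)
  basis₂-InEMC {a} {b} {c} eul (x ∷ y ∷ z ∷ []) ¬eul with x ≟ a | y ≟ b | z ≟ c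
  ... | yes refl | yes refl | yes refl = case trans (sym eul) ¬eul of λ ()
  ... | no _     | _        | _        = refl
  ... | yes _    | no _     | _        = refl
  ... | yes _    | yes _    | no _     = refl

  basis₂-middle-sum : ∀ a b c y₀ y₁ →
    sumFin n (λ v → basis₂ a b c (y₀ ∷ v ∷ y₁ ∷ [])) ≡ (if ⌊ y₀ ≟ a ⌋ ∧ ⌊ y₁ ≟ c ⌋ then 1ℤ else 0ℤ)
  basis₂-middle-sum a b c y₀ y₁ with y₀ ≟ a | y₁ ≟ c
  ... | yes refl | yes refl =
    trans (sumFin-single n _ b λ v v≢b → cong (λ t → if t ∧ true then 1ℤ else 0ℤ) (isYes-false (v ≟ b) v≢b))
          (cong (λ t → if t ∧ true then 1ℤ else 0ℤ) (isYes-true (b ≟ b) refl))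
  ... | no _     | _        = sumFin-0 n
  ... | yes _    | no _     = sumFin-zero n λ v → cong (λ t → if t then 1ℤ else 0ℤ) (∧-zeroʳ _)

  cycle₂-intro : ∀ c → (∀ y₀ y₁ → isTrail G 2 (y₀ ∷ y₁ ∷ []) ≡ true → sumFin n (λ v → c (y₀ ∷ v ∷ y₁ ∷ [])) ≡ 0ℤ) →
    IsCycle G 2 2 c
  cycle₂-intro c middle≡0 (y₀ ∷ y₁ ∷ []) with isTrail G 2 (y₀ ∷ y₁ ∷ []) in tr
  ... | false = refl
  ... | true rewrite middle≡0 y₀ y₁ tr = refl

  triangle-cycle : ∀ {a b c} → adj a c ≡ true → IsCycle G 2 2 (basis₂ a b c)
  triangle-cycle {a} {b} {c} ac = cycle₂-intro (basis₂ a b c) middle≡0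
    where
    middle≡0 : ∀ y₀ y₁ → isTrail G 2 (y₀ ∷ y₁ ∷ []) ≡ true → sumFin n (λ v → basis₂ a b c (y₀ ∷ v ∷ y₁ ∷ [])) ≡ 0ℤ
    middle≡0 y₀ y₁ tr rewrite basis₂-middle-sum a b c y₀ y₁ with y₀ ≟ a | y₁ ≟ c
    ... | yes refl | yes refl =
      case trans (sym (cong (λ d → addM G d (just 0)) (adj⇒dist≡1 ac))) (proj₂ (isTrail⁻ (a ∷ c ∷ []) tr)) of λ ()
    ... | no _     | _        = refl
    ... | yes _    | no _     = refl

  square-chain : Fin n → Fin n → Fin n → Fin n → Chain G 2
  square-chain a b b′ c = _+ᶜ_ G (basis₂ a b c) (-ᶜ_ G (basis₂ a b′ c))

  square-cycle : ∀ a b b′ c → IsCycle G 2 2 (square-chain a b b′ c)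
  square-cycle a b b′ c = cycle₂-intro (square-chain a b b′ c) λ y₀ y₁ _ → begin
    sumFin n (λ v → basis₂ a b c (y₀ ∷ v ∷ y₁ ∷ []) - basis₂ a b′ c (y₀ ∷ v ∷ y₁ ∷ []))
      ≡⟨ sumFin-+ n _ _ ⟩
    sumFin n (λ v → basis₂ a b c (y₀ ∷ v ∷ y₁ ∷ [])) + sumFin n (λ v → - basis₂ a b′ c (y₀ ∷ v ∷ y₁ ∷ []))
      ≡⟨ cong₂ _+_ (basis₂-middle-sum a b c y₀ y₁)
                   (trans (sumFin-neg n _) (cong -_ (basis₂-middle-sum a b′ c y₀ y₁))) ⟩
    (if ⌊ y₀ ≟ a ⌋ ∧ ⌊ y₁ ≟ c ⌋ then 1ℤ else 0ℤ) - (if ⌊ y₀ ≟ a ⌋ ∧ ⌊ y₁ ≟ c ⌋ then 1ℤ else 0ℤ)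
      ≡⟨ ℤ.+-inverseʳ (if ⌊ y₀ ≟ a ⌋ ∧ ⌊ y₁ ≟ c ⌋ then 1ℤ else 0ℤ) ⟩
    0ℤ ∎
    where open ≡-Reasoning

  eulerian-2-cycles-vanish⇒triangle-free : EulerianCyclesVanish 2 → TriangleFree
  eulerian-2-cycles-vanish⇒triangle-free vanish {a} {b} {c} ab bc ac =
    case trans (sym (basis₂-at a b c))
      (vanish _ (basis₂-InEMC (path-isEulerianTrail ab bc (adj⇒≢ ac))) (triangle-cycle ac) (a ∷ b ∷ c ∷ [])) of λ ()

  eulerian-2-cycles-vanish⇒square-free : EulerianCyclesVanish 2 → SquareFree
  eulerian-2-cycles-vanish⇒square-free vanish {a} {b} {b′} {c} a≢c ab bc ab′ b′c with b ≟ b′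
  ... | yes b≡b′ = b≡b′
  ... | no b≢b′ = case trans (sym value) (vanish _ inEMC (square-cycle a b b′ c) (a ∷ b ∷ c ∷ [])) of λ ()
    where
    value : square-chain a b b′ c (a ∷ b ∷ c ∷ []) ≡ 1ℤ
    value rewrite isYes-true (a ≟ a) refl | isYes-true (b ≟ b) refl | isYes-true (c ≟ c) refl
                | isYes-false (b ≟ b′) b≢b′ = refl
    inEMC : InEMC G 2 2 (square-chain a b b′ c)
    inEMC = vanish-+ G (isEulerianTrail G 2) _ _ (basis₂-InEMC (path-isEulerianTrail ab bc a≢c))
              (vanish-neg G (isEulerianTrail G 2) _ (basis₂-InEMC (path-isEulerianTrail ab′ b′c a≢c)))

  module _ (triangle-free : TriangleFree) (square-free : SquareFree) where

    -- Inserting a vertex into face x j yields a trail only for x itself: elsewhere it needs the edge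
    -- x_j x_{j+2}, closing a triangle; at 1 + j the new vertex is a common neighbour of x_j and x_{j+2},
    -- hence x_{j+1} as there are no squares.
    ∂-face : ∀ {k} {c : Chain G (suc k)} → InMC G (suc k) (suc k) c → (x : Vec (Fin n) (2 ℕ.+ k)) → IsWalk x →
      (j : Fin k) → ¬ Backtrack x j → ∂ G k (suc k) c (face x j) ≡ sign (suc (toℕ j)) * c x
    ∂-face {k} {c} inMC x walk j ¬back = begin
      ∂ G k (suc k) c y
        ≡⟨ if-cong (let cd , len = face-shape x j walk ¬back ¬ad in isTrail-intro y cd len) ⟩
      sumFin k (λ i → sign (suc (toℕ i)) * sumFin n (λ v → c (insertAt y (suc (inject₁ i)) v)))
        ≡⟨ sumFin-single k _ j (λ i i≢j → trans (cong (sign (suc (toℕ i)) *_) (sumFin-zero n (elsewhere i i≢j)))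
                                                (ℤ.*-zeroʳ (sign (suc (toℕ i))))) ⟩
      sign (suc (toℕ j)) * sumFin n (λ v → c (insertAt y (suc (inject₁ j)) v))
        ≡⟨ cong (sign (suc (toℕ j)) *_) (sumFin-single n _ b other-vertex) ⟩
      sign (suc (toℕ j)) * c (insertAt y (suc (inject₁ j)) b)
        ≡⟨ cong (λ z → sign (suc (toℕ j)) * c z) (insertAt-removeAt x (suc (inject₁ j))) ⟩
      sign (suc (toℕ j)) * c x ∎
      where
      open ≡-Reasoning
      y = face x j
      a = lookup x (inject₁ (inject₁ j))
      b = lookup x (suc (inject₁ j))
      d = lookup x (suc (suc j))
      ab : adj a b ≡ true
      ab = walk-step x (inject₁ j) walk
      bd : adj b d ≡ true
      bd = walk-step x (suc j) walk
      ¬ad : adj a d ≡ false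
      ¬ad = ¬-not (triangle-free ab bd)
      elsewhere : ∀ i → i ≢ j → ∀ v → c (insertAt y (suc (inject₁ i)) v) ≡ 0ℤ
      elsewhere i i≢j v = InMC⇒supported-on-walks inMC _ λ w →
        case trans (sym ¬ad) (subst₂ (λ p q → adj p q ≡ true) (face-lookup-left x j) (face-lookup-right x j)
               (walk-insertAt-elsewhere y _ v j w (i≢j ∘ FinP.inject₁-injective ∘ FinP.suc-injective))) of λ ()
      other-vertex : ∀ v → v ≢ b → c (insertAt y (suc (inject₁ j)) v) ≡ 0ℤ
      other-vertex v v≢b = InMC⇒supported-on-walks inMC _ λ w →
        let av , vd = walk-insertAt y j v w in
        v≢b (sym (square-free ¬back ab bd (subst (λ p → adj p v ≡ true) (face-lookup-left x j) av)
                                         (subst (λ q → adj v q ≡ true) (face-lookup-right x j) vd)))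

    module _ {k} (4≤k : 4 ≤ k) {c : Chain G (suc k)} (inMC : InMC G (suc k) (suc k) c)
             (dcyc : IsDCycle G (suc k) (suc k) c) where

      D-cycle-vanishes-off-eulerian : ∀ x → allDistinct G x ≡ false → (j : Fin k) → ¬ Backtrack x j → c x ≡ 0ℤ
      D-cycle-vanishes-off-eulerian x nd j ¬back with isTrail G (suc k) x in tr
      ... | false = inMC x tr
      ... | true with deletable-face 4≤k x nd j ¬back
      ... | j′ , ¬back′ , nd′ = sign*≡0⇒≡0 (suc (toℕ j′)) (c x) (begin
        sign (suc (toℕ j′)) * c x    ≡⟨ ∂-face inMC x (trail⇒walk x tr) j′ ¬back′ ⟨
        ∂ G k (suc k) c (face x j′)  ≡⟨ dcyc (face x j′) face-not-eulerian ⟩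
        0ℤ                           ∎)
        where
        open ≡-Reasoning
        face-not-eulerian : isEulerianTrail G (suc k) (face x j′) ≡ false
        face-not-eulerian rewrite nd′ = ∧-zeroʳ _

      non-eulerian-part : Chain G (suc k)
      non-eulerian-part x = if allDistinct G x then 0ℤ else c x

      non-eulerian-part-InMC : InMC G (suc k) (suc k) non-eulerian-part
      non-eulerian-part-InMC x ¬tr with allDistinct G x
      ... | true  = refl
      ... | false = inMC x ¬tr

      non-eulerian-part-cycle : IsCycle G (suc k) (suc k) non-eulerian-part
      non-eulerian-part-cycle y with isTrail G (suc k) y in tr
      ... | false = refl
      ... | true  = sumFin-zero k λ j →
        trans (cong (sign (suc (toℕ j)) *_) (sumFin-zero n (inserted j))) (ℤ.*-zeroʳ (sign (suc (toℕ j))))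
        where
        inserted : ∀ j v → non-eulerian-part (insertAt y (suc (inject₁ j)) v) ≡ 0ℤ
        inserted j v with allDistinct G (insertAt y (suc (inject₁ j)) v) in nd
        ... | true  = refl
        ... | false = D-cycle-vanishes-off-eulerian _ nd j
          (consecDistinct-step y j (proj₁ (isTrail⁻ y tr)) ∘ insertAt-Backtrack y j v)

      non-eulerian-part-−c-InEMC : InEMC G (suc k) (suc k) (λ x → non-eulerian-part x - c x)
      non-eulerian-part-−c-InEMC x ¬eul with allDistinct G x
      ... | false = ℤ.+-inverseʳ (c x)
      ... | true  = trans (ℤ.+-identityˡ (- c x)) (cong -_ (inMC x (trans (sym (∧-identityʳ _)) ¬eul)))

  IsCycle⇒IsDCycle : ∀ k ℓ {c} → IsCycle G k ℓ c → IsDCycle G k ℓ c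
  IsCycle⇒IsDCycle zero    ℓ _   = tt
  IsCycle⇒IsDCycle (suc k) ℓ cyc = λ y _ → cyc y

  module _ (k : ℕ) where
    open RawGroup (MH G k k) using () renaming (Carrier to MHₖ; _≈_ to _≈ᴹ_; _∙_ to _∙ᴹ_; ε to εᴹ; _⁻¹ to _⁻¹ᴹ)
    open RawGroup (DMH G k k) using () renaming (Carrier to DMHₖ; _≈_ to _≈ᴰ_; _∙_ to _∙ᴰ_; ε to εᴰ; _⁻¹ to _⁻¹ᴰ)

    MH→DMH : MHₖ → DMHₖ
    MH→DMH (c , inMC , cyc) = c , inMC , IsCycle⇒IsDCycle k k cyc

    ≈ᴰ-refl : ∀ d → d ≈ᴰ d
    ≈ᴰ-refl (c , _) = 0ᶜ G , 0ᶜ G , vanish-0 G (isTrail G k) , vanish-0 G (isEulerianTrail G k) , λ x → begin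
      c x - c x              ≡⟨ ℤ.+-inverseʳ (c x) ⟩
      0ℤ                     ≡⟨ ∂-0 G k k x ⟨
      ∂ G k k (0ᶜ G) x       ≡⟨ ℤ.+-identityʳ _ ⟨
      ∂ G k k (0ᶜ G) x + 0ℤ  ∎
      where open ≡-Reasoning

    MH→DMH-homo : ∀ m m′ → MH→DMH (m ∙ᴹ m′) ≈ᴰ (MH→DMH m ∙ᴰ MH→DMH m′)
    MH→DMH-homo m m′ = ≈ᴰ-refl (MH→DMH (m ∙ᴹ m′))

    MH→DMH-ε : MH→DMH εᴹ ≈ᴰ εᴰ
    MH→DMH-ε = ≈ᴰ-refl εᴰ

    MH→DMH-⁻¹ : ∀ m → MH→DMH (m ⁻¹ᴹ) ≈ᴰ (MH→DMH m ⁻¹ᴰ)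
    MH→DMH-⁻¹ m = ≈ᴰ-refl (MH→DMH m ⁻¹ᴰ)

    MH→DMH-cong : ∀ {m m′} → m ≈ᴹ m′ → MH→DMH m ≈ᴰ MH→DMH m′
    MH→DMH-cong (b , inMCᵇ , c-c′≡∂b) =
      b , 0ᶜ G , inMCᵇ , vanish-0 G (isEulerianTrail G k) , λ x → trans (c-c′≡∂b x) (sym (ℤ.+-identityʳ _))

    MH→DMH-injective : EulerianCyclesVanish k → ∀ {m m′} → MH→DMH m ≈ᴰ MH→DMH m′ → m ≈ᴹ m′
    MH→DMH-injective vanish {c , _ , cyc} {c′ , _ , cyc′} (b , e , inMCᵇ , inEMCᵉ , c-c′≡∂b+e) =
      0ᶜ G , vanish-0 G (isTrail G k) , λ x → trans (c-c′≡0 x) (sym (∂-0 G k k x))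
      where
      c-c′≡e : ∀ x → c x - c′ x ≡ e x
      c-c′≡e x = trans (c-c′≡∂b+e x) (trans (cong (_+ e x) (∂-zero k k (InMC-short⇒0 inMCᵇ) x)) (ℤ.+-identityˡ (e x)))
      c-c′≡0 : ∀ x → c x - c′ x ≡ 0ℤ
      c-c′≡0 = vanish (_+ᶜ_ G c (-ᶜ_ G c′)) (λ x ¬eul → trans (c-c′≡e x) (inEMCᵉ x ¬eul))
                 (cyc-+ G k k c _ cyc (cyc-neg G k k c′ cyc′))

  MH→DMH-surjective : ∀ {k} → 4 ≤ k → TriangleFree → SquareFree →
    Surjective (RawGroup._≈_ (MH G (suc k) (suc k))) (RawGroup._≈_ (DMH G (suc k) (suc k))) (MH→DMH (suc k))
  MH→DMH-surjective 4≤k triangle-free square-free (c , inMC , dcyc) =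
    (a , non-eulerian-part-InMC triangle-free square-free 4≤k inMC dcyc
       , non-eulerian-part-cycle triangle-free square-free 4≤k inMC dcyc) ,
    λ { {c″ , _} (b , inMCᵇ , c″-a≡∂b) →
          b , (λ x → a x - c x) , inMCᵇ , non-eulerian-part-−c-InEMC triangle-free square-free 4≤k inMC dcyc ,
          λ x → trans (sym (ℤ.+-minus-telescope (c″ x) (a x) (c x))) (cong (_+ (a x - c x)) (c″-a≡∂b x)) }
    where
    a = non-eulerian-part triangle-free square-free 4≤k inMC dcyc

  MH≅DMH : ∀ {k} → 4 ≤ k → TriangleFree → SquareFree → EulerianCyclesVanish (suc k) →
    MH G (suc k) (suc k) ≅ DMH G (suc k) (suc k)
  MH≅DMH {k} 4≤k triangle-free square-free vanish = MH→DMH (suc k) , record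
    { isGroupMonomorphism = record
      { isGroupHomomorphism = record
        { isMonoidHomomorphism = record
          { isMagmaHomomorphism = record
            { isRelHomomorphism = record { cong = λ {m} {m′} → MH→DMH-cong (suc k) {m} {m′} }
            ; homo = MH→DMH-homo (suc k) }
          ; ε-homo = MH→DMH-ε (suc k) }
        ; ⁻¹-homo = MH→DMH-⁻¹ (suc k) }
      ; injective = λ {m} {m′} → MH→DMH-injective (suc k) vanish {m} {m′} }
    ; surjective = MH→DMH-surjective 4≤k triangle-free square-free }

theorem3p3 : (k : ℕ) → 5 ≤ k → (G : Graph) →
    EMH G 2 2 ≅ TrivialGroup → EMH G k k ≅ TrivialGroup →
    MH G k k ≅ DMH G k k
theorem3p3 (suc k) (s≤s 4≤k) G EMH₂₂≅0 EMHₖₖ≅0 =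
  MH≅DMH G 4≤k (eulerian-2-cycles-vanish⇒triangle-free G vanish₂) (eulerian-2-cycles-vanish⇒square-free G vanish₂)
    (EMH≅0⇒eulerian-cycles-vanish G (suc k) EMHₖₖ≅0)
  where
  vanish₂ : EulerianCyclesVanish G 2
  vanish₂ = EMH≅0⇒eulerian-cycles-vanish G 2 EMH₂₂≅0
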